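{- Let $G$ be an elementary abelian $2$-group of order $n=2^r$, and let $h$ be an integer with $n/2-1\le h\le n-2$. Then $Z_h(G)=h$ if $h=n-4$, and $Z_h(G)=h+2$ otherwise.
   Context: $G$ is written additively. For $A\subseteq G$ and a positive integer $h$, $h\hat{\;}A$ denotes the set of all sums of $h$ pairwise distinct elements of $A$. $Z_h(G)=\max\{|A| : A\subseteq G,\ 0\notin h\hat{\;}A\}$. -}

module Defs where

open import Data.Bool using (Bool; false; _xor_)
open import Data.Nat using (ℕ; _≤_)
open import Data.Vec using (Vec; zipWith; replicate)
open import Data.List using (List; length; foldr)
open import Data.List.Relation.Unary.Unique.Propositional using (Unique)
open import Data.List.Relation.Binary.Sublist.Propositional using (_⊆_)
open import Data.Product using (_×_; ∃)
open import Relation.Binary.PropositionalEquality using (_≡_)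
open import Relation.Nullary using (¬_)

-- The elementary abelian 2-group of order 2^r, realised as (Z/2)^r:
-- bit-vectors of length r under componentwise xor.
G : ℕ → Set
G r = Vec Bool r

_⊕_ : ∀ {r} → G r → G r → G r
_⊕_ = zipWith _xor_

0G : ∀ {r} → G r
0G {r} = replicate r false

sumG : ∀ {r} → List (G r) → G r
sumG = foldr _⊕_ 0G

-- For a finite set A ⊆ G given as a duplicate-free list,
-- 0 ∈ h^A  iff  some sub-list of A of length h (i.e. h pairwise distinct
-- elements of A) sums to 0.
ZeroIn-hA : ∀ {r} → ℕ → List (G r) → Set
ZeroIn-hA h A = ∃ λ S → S ⊆ A × length S ≡ h × sumG S ≡ 0G

IsZh : ℕ → ℕ → ℕ → Set
IsZh r h m =
  (∃ λ (A : List (G r)) → Unique A × length A ≡ m × ¬ ZeroIn-hA h A)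
  × (∀ (A : List (G r)) → Unique A → ¬ ZeroIn-hA h A → length A ≤ m)

{-# OPTIONS --safe #-}
-- Write n = 2 ^ r and Σ X for the sum of X ⊆ G. For r ≥ 2 the elements of G sum to 0, so a set
-- and its complement in G have the same sum; and 0 ∈ h^A iff A has |A| - h elements summing to Σ A.
-- Lower bounds: the complement of a 4-set with nonzero sum (when h = n - 4), and the complement of a
-- zero-sum set of size n - h - 2 ≠ 2, as no two distinct elements sum to 0.
-- Upper bound when h = n - 4: a set L of h + 1 elements either contains Σ L, or L ∪ {Σ L} misses
-- exactly two elements of G, which would sum to 0.
-- Upper bound otherwise: for |L| = h + 3 pick a ∈ L with a ≠ Σ L, so t = Σ L + a ≠ 0. Then L ∖ {a}
-- has h + 2 > n / 2 elements, hence meets its translate by t: it contains b and c = b + t, and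
-- removing a, b, c from L leaves h elements summing to Σ L + a + t = 0.
module Submission where

open import Defs
open import Algebra.Bundles using (AbelianGroup)
import Algebra.Properties.AbelianGroup as AbelianGroupProperties
open import Data.Bool using (Bool; true; false; not; _xor_)
import Data.Bool as Bool
open import Data.Bool.Properties using (xor-assoc; xor-comm; xor-identityˡ; xor-identityʳ; xor-same; not-distribˡ-xor)
open import Data.Empty using (⊥-elim)
open import Data.List using (List; []; _∷_; [_]; _++_; map; take; length)
open import Data.List.Properties using (length-++; length-map; length-take)
open import Data.List.Membership.Propositional using (_∈_; _─_; find; lose)
open import Data.List.Membership.Propositional.Properties using (∈-++⁺ˡ; ∈-++⁺ʳ; ∈-map⁺; ∈-map⁻)
open import Data.List.Relation.Binary.Permutation.Propositional using (_↭_; ↭-refl; ↭-prep; ↭-swap; ↭-trans; ↭⇒↭ₛ)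
open import Data.List.Relation.Binary.Permutation.Propositional.Properties using (↭-length; ∈-resp-↭)
import Data.List.Relation.Binary.Permutation.Setoid.Properties as PermutationProperties
import Data.List.Membership.DecPropositional as DecMembership
open import Data.List.Relation.Binary.Sublist.Propositional using (_⊆_; []; _∷_; _∷ʳ_; ⊆-refl; ⊆-trans)
open import Data.List.Relation.Binary.Sublist.Propositional.Properties using (All-resp-⊆; Any-resp-⊆; take-⊆)
open import Data.List.Relation.Unary.All as All using (All; []; _∷_)
import Data.List.Relation.Unary.All.Properties as All
open import Data.List.Relation.Unary.AllPairs using ([]; _∷_)
open import Data.List.Relation.Unary.Any using (here; there; any?)
open import Data.List.Relation.Unary.Unique.Propositional using (Unique)
import Data.List.Relation.Unary.Unique.Propositional.Properties as Unique
open import Data.Nat using (ℕ; zero; suc; _≤_; _<_; _+_; _*_; _^_; s≤s; _≤?_)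
open import Data.Nat.Properties
  using (+-comm; +-assoc; +-suc; +-identityʳ; +-cancelˡ-≡; +-cancelˡ-≤; +-monoˡ-≤; *-monoʳ-≤; *-monoʳ-<;
         *-cancelˡ-≤; suc-injective; 1+n≢0; n≤1+n; n<1+n; m≤m+n; m≤n+m; ≤-trans; <⇒≱; ≰⇒>;
         m≤n⇒m⊓n≡m; m≤n⇒∃[o]m+o≡n; m<n⇒m≤1+n; module ≤-Reasoning)
open import Data.Product using (_×_; ∃; _,_; uncurry)
open import Data.Vec using ([]; _∷_)
open import Data.Vec.Properties using (zipWith-assoc; zipWith-comm; zipWith-identityˡ; zipWith-identityʳ; ∷-injectiveʳ; ≡-dec)
open import Function using (id; _∘_)
open import Level using (0ℓ)
open import Relation.Binary.Definitions using (DecidableEquality)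
open import Relation.Binary.PropositionalEquality using (_≡_; _≢_; refl; sym; trans; cong; cong₂; subst; setoid; isEquivalence; module ≡-Reasoning)
open import Relation.Nullary using (¬_; yes; no)

⊕-assoc : ∀ {r} (x y z : G r) → (x ⊕ y) ⊕ z ≡ x ⊕ (y ⊕ z)
⊕-assoc = zipWith-assoc xor-assoc

⊕-comm : ∀ {r} (x y : G r) → x ⊕ y ≡ y ⊕ x
⊕-comm = zipWith-comm xor-comm

⊕-identityˡ : ∀ {r} (x : G r) → 0G ⊕ x ≡ x
⊕-identityˡ = zipWith-identityˡ xor-identityˡ

⊕-identityʳ : ∀ {r} (x : G r) → x ⊕ 0G ≡ x
⊕-identityʳ = zipWith-identityʳ xor-identityʳ

⊕-self : ∀ {r} (x : G r) → x ⊕ x ≡ 0G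
⊕-self [] = refl
⊕-self (b ∷ x) = cong₂ _∷_ (xor-same b) (⊕-self x)

⊕-abelianGroup : ℕ → AbelianGroup 0ℓ 0ℓ
⊕-abelianGroup r = record
  { Carrier = G r
  ; _≈_ = _≡_
  ; _∙_ = _⊕_
  ; ε = 0G
  ; _⁻¹ = id
  ; isAbelianGroup = record
    { isGroup = record
      { isMonoid = record
        { isSemigroup = record
          { isMagma = record { isEquivalence = isEquivalence ; ∙-cong = cong₂ _⊕_ }
          ; assoc = ⊕-assoc
          }
        ; identity = ⊕-identityˡ , ⊕-identityʳ
        }
      ; inverse = ⊕-self , ⊕-self
      ; ⁻¹-cong = id
      }
    ; comm = ⊕-comm
    }
  }

module ⊕ {r : ℕ} = AbelianGroupProperties (⊕-abelianGroup r)

⊕≡0⇒≡ : ∀ {r} {x y : G r} → x ⊕ y ≡ 0G → x ≡ y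
⊕≡0⇒≡ {x = x} {y} x⊕y≡0 = sym (⊕.inverseʳ-unique x y x⊕y≡0)

x⊕[y⊕x]≡y : ∀ {r} (x y : G r) → x ⊕ (y ⊕ x) ≡ y
x⊕[y⊕x]≡y x y = trans (sym (⊕-assoc x y x)) (⊕.xyx⁻¹≈y x y)

_≟ᴳ_ : ∀ {r} → DecidableEquality (G r)
_≟ᴳ_ = ≡-dec Bool._≟_

sumG-++ : ∀ {r} (xs ys : List (G r)) → sumG (xs ++ ys) ≡ sumG xs ⊕ sumG ys
sumG-++ [] ys = sym (⊕-identityˡ (sumG ys))
sumG-++ (x ∷ xs) ys = trans (cong (x ⊕_) (sumG-++ xs ys)) (sym (⊕-assoc x _ _))

sumG-↭ : ∀ {r} {xs ys : List (G r)} → xs ↭ ys → sumG xs ≡ sumG ys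
sumG-↭ {r} xs↭ys = foldr-commMonoid isCommutativeMonoid (↭⇒↭ₛ xs↭ys)
  where
  open AbelianGroup (⊕-abelianGroup r) using (isCommutativeMonoid)
  open PermutationProperties (setoid (G r)) using (foldr-commMonoid)

length-split : ∀ {A : Set} {xs ys zs : List A} → xs ↭ ys ++ zs → length xs ≡ length ys + length zs
length-split {ys = ys} σ = trans (↭-length σ) (length-++ ys)

sumG-split : ∀ {r} {xs ys zs : List (G r)} → xs ↭ ys ++ zs → sumG xs ≡ sumG ys ⊕ sumG zs
sumG-split {ys = ys} σ = trans (sumG-↭ σ) (sumG-++ ys _)

module _ {A : Set} where

  ─-↭ : ∀ {x : A} {xs} (p : x ∈ xs) → xs ↭ x ∷ xs ─ p
  ─-↭ (here refl) = ↭-refl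
  ─-↭ (there p) = ↭-trans (↭-prep _ (─-↭ p)) (↭-swap _ _ ↭-refl)

  ─-⊆ : ∀ {x : A} {xs} (p : x ∈ xs) → xs ─ p ⊆ xs
  ─-⊆ {xs = y ∷ _} (here _) = y ∷ʳ ⊆-refl
  ─-⊆ (there p) = refl ∷ ─-⊆ p

  ∈-─⁺ : ∀ {x y : A} {xs} (p : x ∈ xs) → x ≢ y → y ∈ xs → y ∈ xs ─ p
  ∈-─⁺ p x≢y y∈xs with ∈-resp-↭ (─-↭ p) y∈xs
  ... | here y≡x = ⊥-elim (x≢y (sym y≡x))
  ... | there y∈xs─p = y∈xs─p

  Unique-⊆ : ∀ {xs ys : List A} → xs ⊆ ys → Unique ys → Unique xs
  Unique-⊆ [] [] = []
  Unique-⊆ (_ ∷ʳ xs⊆ys) (_ ∷ uys) = Unique-⊆ xs⊆ys uys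
  Unique-⊆ (refl ∷ xs⊆ys) (y∉ys ∷ uys) = All-resp-⊆ xs⊆ys y∉ys ∷ Unique-⊆ xs⊆ys uys

  ∃-complement : ∀ {xs ys : List A} → Unique xs → Unique ys → All (_∈ ys) xs →
                 ∃ λ zs → Unique zs × ys ↭ xs ++ zs
  ∃-complement [] uys [] = _ , uys , ↭-refl
  ∃-complement (x∉xs ∷ uxs) uys (x∈ys ∷ xs⊆ys)
    with zs , uzs , σ ← ∃-complement uxs (Unique-⊆ (─-⊆ x∈ys) uys) (All.zipWith (uncurry (∈-─⁺ x∈ys)) (x∉xs , xs⊆ys))
    = zs , uzs , ↭-trans (─-↭ x∈ys) (↭-prep _ σ)

elements : ∀ r → List (G r)
elements zero = [ [] ]
elements (suc r) = map (false ∷_) (elements r) ++ map (true ∷_) (elements r)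

length-elements : ∀ r → length (elements r) ≡ 2 ^ r
length-elements zero = refl
length-elements (suc r) = begin
  length (map (false ∷_) E ++ map (true ∷_) E)  ≡⟨ length-++ (map (false ∷_) E) ⟩
  length (map (false ∷_) E) + length (map (true ∷_) E)
    ≡⟨ cong₂ _+_ (length-map (false ∷_) E) (length-map (true ∷_) E) ⟩
  length E + length E  ≡⟨ cong (λ n → n + n) (length-elements r) ⟩
  2 ^ r + 2 ^ r        ≡⟨ cong (2 ^ r +_) (sym (+-identityʳ (2 ^ r))) ⟩
  2 ^ suc r            ∎
  where
  open ≡-Reasoning
  E = elements r

∈-elements : ∀ {r} (x : G r) → x ∈ elements r
∈-elements [] = here refl
∈-elements {suc r} (false ∷ x) = ∈-++⁺ˡ (∈-map⁺ (false ∷_) (∈-elements x))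
∈-elements {suc r} (true ∷ x) = ∈-++⁺ʳ (map (false ∷_) (elements r)) (∈-map⁺ (true ∷_) (∈-elements x))

elements-unique : ∀ r → Unique (elements r)
elements-unique zero = [] ∷ []
elements-unique (suc r) =
  Unique.++⁺ (Unique.map⁺ ∷-injectiveʳ (elements-unique r)) (Unique.map⁺ ∷-injectiveʳ (elements-unique r)) disjoint
  where
  disjoint : ∀ {v} → ¬ (v ∈ map (false ∷_) (elements r) × v ∈ map (true ∷_) (elements r))
  disjoint (v∈₀ , v∈₁) with ∈-map⁻ (false ∷_) v∈₀ | ∈-map⁻ (true ∷_) v∈₁
  ... | _ , _ , refl | _ , _ , ()

oddLength : ∀ {A : Set} → List A → Bool
oddLength [] = false
oddLength (_ ∷ xs) = not (oddLength xs)

oddLength-++ : ∀ {A : Set} (xs ys : List A) → oddLength (xs ++ ys) ≡ oddLength xs xor oddLength ys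
oddLength-++ [] ys = refl
oddLength-++ (_ ∷ xs) ys = trans (cong not (oddLength-++ xs ys)) (not-distribˡ-xor (oddLength xs) (oddLength ys))

oddLength-map : ∀ {A B : Set} (f : A → B) (xs : List A) → oddLength (map f xs) ≡ oddLength xs
oddLength-map f [] = refl
oddLength-map f (_ ∷ xs) = cong not (oddLength-map f xs)

sumG-map-false∷ : ∀ {r} (xs : List (G r)) → sumG (map (false ∷_) xs) ≡ false ∷ sumG xs
sumG-map-false∷ [] = refl
sumG-map-false∷ (x ∷ xs) = cong ((false ∷ x) ⊕_) (sumG-map-false∷ xs)

sumG-map-true∷ : ∀ {r} (xs : List (G r)) → sumG (map (true ∷_) xs) ≡ oddLength xs ∷ sumG xs
sumG-map-true∷ [] = refl
sumG-map-true∷ (x ∷ xs) = cong ((true ∷ x) ⊕_) (sumG-map-true∷ xs)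

-- The first coordinate of the sum is the parity of 2 ^ (1 + r); the others cancel in pairs.
sumG-elements : ∀ r → sumG (elements (2 + r)) ≡ 0G
sumG-elements r = begin
  sumG (map (false ∷_) E ++ map (true ∷_) E)          ≡⟨ sumG-++ (map (false ∷_) E) _ ⟩
  sumG (map (false ∷_) E) ⊕ sumG (map (true ∷_) E)
    ≡⟨ cong₂ _⊕_ (sumG-map-false∷ E) (sumG-map-true∷ E) ⟩
  oddLength E ∷ (sumG E ⊕ sumG E)                    ≡⟨ cong₂ _∷_ oddLength-E (⊕-self (sumG E)) ⟩
  0G                                                 ∎
  where
  open ≡-Reasoning
  E = elements (suc r)
  oddLength-E : oddLength E ≡ false
  oddLength-E = begin
    oddLength (map (false ∷_) (elements r) ++ map (true ∷_) (elements r))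
      ≡⟨ oddLength-++ (map (false ∷_) (elements r)) _ ⟩
    oddLength (map (false ∷_) (elements r)) xor oddLength (map (true ∷_) (elements r))
      ≡⟨ cong₂ _xor_ (oddLength-map _ (elements r)) (oddLength-map _ (elements r)) ⟩
    oddLength (elements r) xor oddLength (elements r)  ≡⟨ xor-same (oddLength (elements r)) ⟩
    false                                              ∎

complementᴳ : ∀ {r} {xs : List (G r)} → Unique xs → ∃ λ ys → Unique ys × elements r ↭ xs ++ ys
complementᴳ {r} uxs = ∃-complement uxs (elements-unique r) (All.universal ∈-elements _)

complement-size : ∀ {r} {xs ys : List (G r)} → elements r ↭ xs ++ ys → length xs + length ys ≡ 2 ^ r
complement-size {r} {xs} σ = trans (sym (length-split {ys = xs} σ)) (length-elements r)

complement-sum : ∀ {r} {xs ys : List (G (2 + r))} → elements (2 + r) ↭ xs ++ ys → sumG xs ≡ sumG ys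
complement-sum {r} {xs} σ = ⊕≡0⇒≡ (trans (sym (sumG-split {ys = xs} σ)) (sumG-elements r))

Unique⇒length≤2^ : ∀ {r} {xs : List (G r)} → Unique xs → length xs ≤ 2 ^ r
Unique⇒length≤2^ {xs = xs} uxs with ys , _ , σ ← complementᴳ uxs =
  subst (length xs ≤_) (complement-size {xs = xs} σ) (m≤m+n _ (length ys))

∃-common : ∀ {r} {xs ys : List (G r)} → Unique xs → Unique ys → 2 ^ r < length xs + length ys →
           ∃ λ x → x ∈ xs × x ∈ ys
∃-common {r} {xs} {ys} uxs uys 2^r< with any? (_∈? ys) xs
  where open DecMembership (_≟ᴳ_ {r}) using (_∈?_)
... | yes xs∩ys = find xs∩ys
... | no xs∩ys≡∅ = ⊥-elim (<⇒≱ 2^r< (begin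
  length xs + length ys   ≡⟨ length-++ xs ⟨
  length (xs ++ ys)       ≤⟨ Unique⇒length≤2^ (Unique.++⁺ uxs uys disjoint) ⟩
  2 ^ r                   ∎))
  where
  open ≤-Reasoning
  disjoint : ∀ {v} → ¬ (v ∈ xs × v ∈ ys)
  disjoint (v∈xs , v∈ys) = xs∩ys≡∅ (lose v∈xs v∈ys)

∃-nonzero-sum : ∀ {r} j → 2 + j ≤ 2 ^ r → ∃ λ (xs : List (G r)) → Unique xs × length xs ≡ suc j × sumG xs ≢ 0G
∃-nonzero-sum {r} j 2+j≤2^r =
  drop-one (take (2 + j) (elements r)) (Unique.take⁺ (2 + j) (elements-unique r))
    (trans (length-take (2 + j) (elements r)) (m≤n⇒m⊓n≡m (subst (2 + j ≤_) (sym (length-elements r)) 2+j≤2^r)))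
  where
  -- x ∷ zs and y ∷ zs cannot both sum to 0, as x ≢ y.
  drop-one : ∀ ws → Unique ws → length ws ≡ 2 + j → ∃ λ xs → Unique xs × length xs ≡ suc j × sumG xs ≢ 0G
  drop-one (x ∷ y ∷ zs) ((x≢y ∷ x∉zs) ∷ y∉zs ∷ uzs) len with sumG (x ∷ zs) ≟ᴳ 0G
  ... | no  Σ≢0 = x ∷ zs , x∉zs ∷ uzs , suc-injective len , Σ≢0
  ... | yes Σ≡0 = y ∷ zs , y∉zs ∷ uzs , suc-injective len ,
                  λ Σ′≡0 → x≢y (⊕.∙-cancelʳ (sumG zs) x y (trans Σ≡0 (sym Σ′≡0)))

∃-zero-sum : ∀ {r} k → k ≢ 2 → k ≤ suc (2 ^ r) →
             ∃ λ (xs : List (G (suc r))) → Unique xs × length xs ≡ k × sumG xs ≡ 0G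
∃-zero-sum 0 _ _ = [] , [] , refl , refl
∃-zero-sum 1 _ _ = [ 0G ] , [] ∷ [] , refl , ⊕-self 0G
∃-zero-sum 2 k≢2 _ = ⊥-elim (k≢2 refl)
∃-zero-sum (suc (suc (suc j))) _ (s≤s 2+j≤2^r) with xs , uxs , len , σ≢0 ← ∃-nonzero-sum j 2+j≤2^r =
  (true ∷ σ) ∷ (true ∷ 0G) ∷ map (false ∷_) xs ,
  ((σ≢0 ∘ ∷-injectiveʳ) ∷ fresh σ) ∷ fresh 0G ∷ Unique.map⁺ ∷-injectiveʳ uxs ,
  cong (2 +_) (trans (length-map (false ∷_) xs) len) ,
  Σ≡0
  where
  σ = sumG xs
  fresh : ∀ v → All ((true ∷ v) ≢_) (map (false ∷_) xs)
  fresh v = All.map⁺ (All.universal (λ _ ()) xs)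
  Σ≡0 : (true ∷ σ) ⊕ ((true ∷ 0G) ⊕ sumG (map (false ∷_) xs)) ≡ 0G
  Σ≡0 = begin
    (true ∷ σ) ⊕ ((true ∷ 0G) ⊕ sumG (map (false ∷_) xs))
      ≡⟨ cong (λ s → (true ∷ σ) ⊕ ((true ∷ 0G) ⊕ s)) (sumG-map-false∷ xs) ⟩
    false ∷ (σ ⊕ (0G ⊕ σ))  ≡⟨ cong (λ s → false ∷ (σ ⊕ s)) (⊕-identityˡ σ) ⟩
    false ∷ (σ ⊕ σ)         ≡⟨ cong (false ∷_) (⊕-self σ) ⟩
    0G                      ∎
    where open ≡-Reasoning

distinct-pair-sum≢0 : ∀ {r} (xs : List (G r)) → Unique xs → length xs ≡ 2 → sumG xs ≢ 0G
distinct-pair-sum≢0 (x ∷ y ∷ []) ((x≢y ∷ []) ∷ _) _ Σ≡0 =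
  x≢y (trans (⊕≡0⇒≡ Σ≡0) (⊕-identityʳ y))

ZeroIn-hA-⊆ : ∀ {r h} {xs ys : List (G r)} → xs ⊆ ys → ZeroIn-hA h xs → ZeroIn-hA h ys
ZeroIn-hA-⊆ xs⊆ys (S , S⊆xs , len , Σ≡0) = S , ⊆-trans S⊆xs xs⊆ys , len , Σ≡0

ZeroIn-hA⇒complement : ∀ {r h} {A : List (G r)} → Unique A → ZeroIn-hA h A →
                       ∃ λ C → Unique C × h + length C ≡ length A × sumG C ≡ sumG A
ZeroIn-hA⇒complement {A = A} uA (S , S⊆A , refl , ΣS≡0)
  with C , uC , σ ← ∃-complement (Unique-⊆ S⊆A uA) uA (All.tabulate (Any-resp-⊆ S⊆A)) =
  C , uC , sym (length-split {ys = S} σ) , sym (begin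
    sumG A            ≡⟨ sumG-split {ys = S} σ ⟩
    sumG S ⊕ sumG C   ≡⟨ cong (_⊕ sumG C) ΣS≡0 ⟩
    0G ⊕ sumG C       ≡⟨ ⊕-identityˡ (sumG C) ⟩
    sumG C            ∎)
  where open ≡-Reasoning

ZeroIn-hA-↭ : ∀ {r h} {L S T : List (G r)} → S ⊆ L → L ↭ T ++ S →
              length T + h ≡ length L → sumG T ≡ sumG L → ZeroIn-hA h L
ZeroIn-hA-↭ {T = T} S⊆L σ len ΣT≡ΣL =
  _ , S⊆L ,
  +-cancelˡ-≡ (length T) _ _ (trans (sym (length-split {ys = T} σ)) (sym len)) ,
  ⊕.identityʳ-unique (sumG T) _ (trans (sym (sumG-split {ys = T} σ)) (sym ΣT≡ΣL))

zero-free⇒length≤ : ∀ {r} h m → (∀ (L : List (G r)) → Unique L → length L ≡ suc m → ZeroIn-hA h L) →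
                    ∀ A → Unique A → ¬ ZeroIn-hA h A → length A ≤ m
zero-free⇒length≤ h m hit A uA 0∉hA with length A ≤? m
... | yes |A|≤m = |A|≤m
... | no  |A|≰m = ⊥-elim (0∉hA (ZeroIn-hA-⊆ (take-⊆ (suc m) A)
        (hit _ (Unique.take⁺ (suc m) uA) (trans (length-take (suc m) A) (m≤n⇒m⊓n≡m (≰⇒> |A|≰m))))))

¬ZeroIn-hA-of-nonzero-sum : ∀ {r h} {A : List (G r)} → Unique A → length A ≡ h → sumG A ≢ 0G → ¬ ZeroIn-hA h A
¬ZeroIn-hA-of-nonzero-sum {h = h} uA |A|≡h ΣA≢0 0∈hA with ZeroIn-hA⇒complement uA 0∈hA
... | [] , _ , _ , 0≡ΣA = ΣA≢0 (sym 0≡ΣA)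
... | _ ∷ C , _ , len , _ = 1+n≢0 (+-cancelˡ-≡ h _ 0 (trans len (trans |A|≡h (sym (+-identityʳ h)))))

¬ZeroIn-hA-of-zero-sum : ∀ {r h} {A : List (G r)} → Unique A → length A ≡ h + 2 → sumG A ≡ 0G → ¬ ZeroIn-hA h A
¬ZeroIn-hA-of-zero-sum {h = h} uA |A|≡h+2 ΣA≡0 0∈hA with C , uC , len , ΣC≡ΣA ← ZeroIn-hA⇒complement uA 0∈hA =
  distinct-pair-sum≢0 C uC (+-cancelˡ-≡ h _ 2 (trans len |A|≡h+2)) (trans ΣC≡ΣA ΣA≡0)

∃-≢ : ∀ {r n} {xs : List (G r)} → Unique xs → length xs ≡ 2 + n → ∀ s → ∃ λ x → x ∈ xs × x ≢ s
∃-≢ {xs = x ∷ y ∷ _} ((x≢y ∷ _) ∷ _) _ s with x ≟ᴳ s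
... | no  x≢s = x , here refl , x≢s
... | yes x≡s = y , there (here refl) , λ y≡s → x≢y (trans x≡s (sym y≡s))

∃-pair-differing-by : ∀ {r} (t : G r) {xs : List (G r)} → Unique xs → 2 ^ r < length xs + length xs →
                      ∃ λ b → ∃ λ c → b ∈ xs × c ∈ xs × c ≡ t ⊕ b
∃-pair-differing-by {r} t {xs} uxs 2^r<
  with c , c∈xs , c∈t⊕xs ← ∃-common uxs (Unique.map⁺ (λ {x} {y} → ⊕.∙-cancelˡ t x y) uxs)
         (subst (2 ^ r <_) (cong (length xs +_) (sym (length-map (t ⊕_) xs))) 2^r<)
  with b , b∈xs , c≡t⊕b ← ∈-map⁻ (t ⊕_) c∈t⊕xs
  = b , c , b∈xs , c∈xs , c≡t⊕b

ZeroIn-hA-when-h+4≡2^ : ∀ r h → h + 4 ≡ 2 ^ (2 + r) →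
                   (L : List (G (2 + r))) → Unique L → length L ≡ suc h → ZeroIn-hA h L
ZeroIn-hA-when-h+4≡2^ r h h+4≡2^ L uL len with sumG L ∈? L
  where open DecMembership (_≟ᴳ_ {2 + r}) using (_∈?_)
... | yes Σ∈L = ZeroIn-hA-↭ (─-⊆ Σ∈L) (─-↭ Σ∈L) (sym len) (⊕-identityʳ (sumG L))
... | no  Σ∉L with C , uC , σ ← complementᴳ (All.¬Any⇒All¬ L Σ∉L ∷ uL) =
  ⊥-elim (distinct-pair-sum≢0 C uC |C|≡2 (trans (sym (complement-sum {xs = sumG L ∷ L} σ)) (⊕-self (sumG L))))
  where
  open ≡-Reasoning
  |C|≡2 : length C ≡ 2
  |C|≡2 = +-cancelˡ-≡ (2 + h) _ _ (begin
    2 + h + length C             ≡⟨ cong (λ n → suc n + length C) len ⟨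
    suc (length L) + length C    ≡⟨ complement-size {xs = sumG L ∷ L} σ ⟩
    2 ^ (2 + r)                  ≡⟨ h+4≡2^ ⟨
    h + 4                        ≡⟨ trans (+-suc h 3) (cong suc (+-suc h 2)) ⟩
    2 + h + 2                    ∎)

ZeroIn-hA-when-large : ∀ r h → 2 ^ r ≤ h + 1 →
                  (L : List (G (suc r))) → Unique L → length L ≡ 3 + h → ZeroIn-hA h L
ZeroIn-hA-when-large r h 2^r≤h+1 L uL len with a , a∈L , a≢Σ ← ∃-≢ uL len (sumG L) =
  hit (∃-pair-differing-by t (Unique-⊆ (─-⊆ a∈L) uL) 2^1+r<)
  where
  s = sumG L
  t = s ⊕ a
  L′ = L ─ a∈L

  |L′|≡2+h : length L′ ≡ 2 + h
  |L′|≡2+h = suc-injective (trans (sym (↭-length (─-↭ a∈L))) len)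

  2^1+r< : 2 ^ suc r < length L′ + length L′
  2^1+r< = begin-strict
    2 ^ suc r            ≤⟨ *-monoʳ-≤ 2 2^r≤h+1 ⟩
    2 * (h + 1)          ≡⟨ cong (2 *_) (+-comm h 1) ⟩
    2 * suc h            <⟨ *-monoʳ-< 2 (n<1+n (suc h)) ⟩
    2 * (2 + h)          ≡⟨ cong (2 + h +_) (+-identityʳ (2 + h)) ⟩
    (2 + h) + (2 + h)    ≡⟨ cong₂ _+_ |L′|≡2+h |L′|≡2+h ⟨
    length L′ + length L′ ∎
    where open ≤-Reasoning

  hit : (∃ λ b → ∃ λ c → b ∈ L′ × c ∈ L′ × c ≡ t ⊕ b) → ZeroIn-hA h L
  hit (b , c , b∈L′ , c∈L′ , c≡t⊕b) =
    ZeroIn-hA-↭ (⊆-trans (─-⊆ c∈L″) (⊆-trans (─-⊆ b∈L′) (─-⊆ a∈L)))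
      (↭-trans (─-↭ a∈L) (↭-prep a (↭-trans (─-↭ b∈L′) (↭-prep b (─-↭ c∈L″)))))
      (sym len) Σabc≡s
    where
    b≢c : b ≢ c
    b≢c b≡c = a≢Σ (sym (⊕≡0⇒≡ (⊕.identityˡ-unique t b (trans (sym c≡t⊕b) (sym b≡c)))))
    c∈L″ = ∈-─⁺ b∈L′ b≢c c∈L′
    open ≡-Reasoning
    Σabc≡s : a ⊕ (b ⊕ (c ⊕ 0G)) ≡ s
    Σabc≡s = begin
      a ⊕ (b ⊕ (c ⊕ 0G))  ≡⟨ cong (λ z → a ⊕ (b ⊕ z)) (trans (⊕-identityʳ c) c≡t⊕b) ⟩
      a ⊕ (b ⊕ (t ⊕ b))   ≡⟨ cong (a ⊕_) (x⊕[y⊕x]≡y b t) ⟩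
      a ⊕ (s ⊕ a)         ≡⟨ x⊕[y⊕x]≡y a s ⟩
      s                   ∎

IsZh-when-h+4≡2^ : ∀ r h → 1 ≤ h → h + 4 ≡ 2 ^ (2 + r) → IsZh (2 + r) h h
IsZh-when-h+4≡2^ r h 1≤h h+4≡2^
  with X , uX , |X|≡4 , ΣX≢0 ← ∃-nonzero-sum 3 (subst (5 ≤_) h+4≡2^ (+-monoˡ-≤ 4 1≤h))
  with A , uA , σ ← complementᴳ uX
  = (A , uA , |A|≡h , ¬ZeroIn-hA-of-nonzero-sum uA |A|≡h (ΣX≢0 ∘ trans (complement-sum {xs = X} σ)))
  , zero-free⇒length≤ h h (ZeroIn-hA-when-h+4≡2^ r h h+4≡2^)
  where
  |A|≡h : length A ≡ h
  |A|≡h = +-cancelˡ-≡ 4 _ _ (begin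
    4 + length A           ≡⟨ cong (_+ length A) |X|≡4 ⟨
    length X + length A    ≡⟨ complement-size {xs = X} σ ⟩
    2 ^ (2 + r)            ≡⟨ h+4≡2^ ⟨
    h + 4                  ≡⟨ +-comm h 4 ⟩
    4 + h                  ∎)
    where open ≡-Reasoning

h+2+k≡2n⇒k<n : ∀ {n h k} → n ≤ h + 1 → h + 2 + k ≡ 2 * n → k < n
h+2+k≡2n⇒k<n {n} {h} {k} n≤h+1 h+2+k≡2n = +-cancelˡ-≤ n _ _ (begin
  n + suc k          ≤⟨ +-monoˡ-≤ (suc k) n≤h+1 ⟩
  h + 1 + suc k      ≡⟨ trans (+-assoc h 1 (suc k)) (sym (+-assoc h 2 k)) ⟩
  h + 2 + k          ≡⟨ h+2+k≡2n ⟩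
  2 * n              ≡⟨ cong (n +_) (+-identityʳ n) ⟩
  n + n              ∎)
  where open ≤-Reasoning

IsZh-when-h+4≢2^ : ∀ r h → 2 ^ suc r ≤ h + 1 → h + 2 ≤ 2 ^ (2 + r) → h + 4 ≢ 2 ^ (2 + r) → IsZh (2 + r) h (h + 2)
IsZh-when-h+4≢2^ r h 2^1+r≤h+1 h+2≤2^ h+4≢2^
  with k , h+2+k≡2^ ← m≤n⇒∃[o]m+o≡n h+2≤2^
  with X , uX , |X|≡k , ΣX≡0 ← ∃-zero-sum k (λ { refl → h+4≢2^ (trans (sym (+-assoc h 2 2)) h+2+k≡2^) })
                                             (m<n⇒m≤1+n (h+2+k≡2n⇒k<n 2^1+r≤h+1 h+2+k≡2^))
  with A , uA , σ ← complementᴳ uX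
  = (A , uA , |A|≡h+2 , ¬ZeroIn-hA-of-zero-sum uA |A|≡h+2 (trans (sym (complement-sum {xs = X} σ)) ΣX≡0))
  , zero-free⇒length≤ h (h + 2) λ L uL len → ZeroIn-hA-when-large (suc r) h 2^1+r≤h+1 L uL (trans len (cong suc (+-comm h 2)))
  where
  |A|≡h+2 : length A ≡ h + 2
  |A|≡h+2 = +-cancelˡ-≡ k _ _ (begin
    k + length A           ≡⟨ cong (_+ length A) |X|≡k ⟨
    length X + length A    ≡⟨ complement-size {xs = X} σ ⟩
    2 ^ (2 + r)            ≡⟨ h+2+k≡2^ ⟨
    h + 2 + k              ≡⟨ +-comm (h + 2) k ⟩
    k + (h + 2)            ∎)
    where open ≡-Reasoning

theorem4p5 : ∀ (r h : ℕ) → 1 ≤ h → 2 ^ r ≤ 2 * (h + 1) → h + 2 ≤ 2 ^ r →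
    (h + 4 ≡ 2 ^ r → IsZh r h h) × (h + 4 ≢ 2 ^ r → IsZh r h (h + 2))
theorem4p5 0 h _ _ h+2≤1 with s≤s () ← ≤-trans (m≤n+m 2 h) h+2≤1
theorem4p5 1 h 1≤h _ h+2≤2 with s≤s (s≤s ()) ← ≤-trans (+-monoˡ-≤ 2 1≤h) h+2≤2
theorem4p5 (suc (suc r)) h 1≤h 2^2+r≤2[h+1] h+2≤2^ =
  IsZh-when-h+4≡2^ r h 1≤h , IsZh-when-h+4≢2^ r h (*-cancelˡ-≤ 2 2^2+r≤2[h+1]) h+2≤2^
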